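{- Let $\mathbb{F}$ be a field of characteristic $2$ and let $S=\{R_0,\dots,R_d\}$ be a quasi-thin association scheme on a finite set $X$. Let $\mathcal{U}=\{U(v): v\in\mathbb{F}S,\ R_0\in U(v),\ \overline{A_i}v=\overline{k_i}v\text{ for all }0\le i\le d\}$ and let $\mathcal{S}$ be the set of all singular subsets of $S$. Then $\mathcal{U}=\mathcal{S}$.
   Context: $S$ is an association scheme on $X$ with relations $R_0$ (diagonal), $R_1,\dots,R_d$, transposes $R_{i^*}$, intersection numbers $p_{ij}^k$ and valencies $k_i=p_{ii^*}^0$; quasi-thin means $k_i\le2$ for all $i$. For nonempty $U,V\subseteq S$, $UV=\{R_k:\exists R_u\in U,R_v\in V,\ p_{uv}^k>0\}$ ($R_i$ stands for $\{R_i\}$). $O_\vartheta(S)=\{R_i:k_i=1\}$. A subset $T\subseteq S$ is singular if (i) $O_\vartheta(S)\subseteq T$ and (ii) $R_xR_{y^*}R_yR_z\subseteq T$ for all $R_x\in O_\vartheta(S)$, $R_y\in S$, $R_z\in T$. $A_i$ is the adjacency matrix of $R_i$, $\overline{A_i}$ its image in $M_X(\mathbb{F})$, $\mathbb{F}S=\mathrm{span}_{\mathbb{F}}\{\overline{A_i}\}$ (with basis $\overline{A_0},\dots,\overline{A_d}$), $\overline{k_i}$ the image of $k_i$ in $\mathbb{F}$. For $v=\sum_i c_i\overline{A_i}\in\mathbb{F}S$, $U(v)=\{R_i\in S: c_i\neq0\}$. -}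

module Defs where

open import Level using (Level; _⊔_)
open import Data.Nat as ℕ using (ℕ; suc; _≤_; _>_)
open import Data.Fin as Fin using (Fin; zero; _≟_)
open import Data.Fin.Subset using (Subset; _∈_)
open import Data.Bool using (_∧_; if_then_else_)
open import Data.List using (length; filterᵇ; allFin)
open import Data.Product using (Σ; ∃; ∃₂; _×_; _,_)
open import Relation.Nullary using (¬_)
open import Relation.Nullary.Decidable using (⌊_⌋)
open import Relation.Binary.PropositionalEquality using (_≡_)
open import Algebra.Bundles using (CommutativeRing)
open import Function.Bundles using (_⇔_)

record Field (c ℓ : Level) : Set (Level.suc (c ⊔ ℓ)) where
  field
    commutativeRing : CommutativeRing c ℓ
  open CommutativeRing commutativeRing public
  field
    0≉1     : ¬ (0# ≈ 1#)
    inverse : ∀ x → ¬ (x ≈ 0#) → ∃ λ y → x * y ≈ 1#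

Char2 : ∀ {c ℓ} → Field c ℓ → Set ℓ
Char2 F = 1# + 1# ≈ 0#
  where open Field F

-- Association schemes on X = Fin n with relations R_0,…,R_d
-- (indexed by Fin (suc d)).  rel x y is the unique i with (x,y) ∈ R_i.

count : ∀ {n d} → (Fin n → Fin n → Fin (suc d)) →
        Fin (suc d) → Fin (suc d) → Fin n → Fin n → ℕ
count {n} rel i j x y =
  length (filterᵇ (λ z → ⌊ rel x z ≟ i ⌋ ∧ ⌊ rel z y ≟ j ⌋) (allFin n))

record AssociationScheme (n d : ℕ) : Set where
  field
    rel      : Fin n → Fin n → Fin (suc d)
    diag     : ∀ x y → (rel x y ≡ zero) ⇔ (x ≡ y)
    nonempty : ∀ i → ∃₂ λ x y → rel x y ≡ i
    tr       : Fin (suc d) → Fin (suc d)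
    tr-spec  : ∀ x y → rel y x ≡ tr (rel x y)
    p        : Fin (suc d) → Fin (suc d) → Fin (suc d) → ℕ
    p-spec   : ∀ i j k x y → rel x y ≡ k → count rel i j x y ≡ p i j k

  val : Fin (suc d) → ℕ
  val i = p i (tr i) zero

  Rels : Set₁
  Rels = Fin (suc d) → Set

  ⟦_⟧ : Fin (suc d) → Rels
  ⟦ i ⟧ j = j ≡ i

  _·_ : Rels → Rels → Rels
  (U · V) k = ∃₂ λ u v → U u × V v × p u v k > 0

  Oθ : Rels
  Oθ i = val i ≡ 1

  Singular : Subset (suc d) → Set
  Singular T =
    (∀ i → Oθ i → i ∈ T) ×
    (∀ x y z → Oθ x → z ∈ T → ∀ w →
       (((⟦ x ⟧ · ⟦ tr y ⟧) · ⟦ y ⟧) · ⟦ z ⟧) w → w ∈ T)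

QuasiThin : ∀ {n d} → AssociationScheme n d → Set
QuasiThin S = ∀ i → val i ≤ 2
  where open AssociationScheme S

module OverField {c ℓ} (F : Field c ℓ) where
  open Field F hiding (zero)

  ∑ : ∀ {n} → (Fin n → Carrier) → Carrier
  ∑ {ℕ.zero}  f = 0#
  ∑ {suc n} f = f zero + ∑ (λ i → f (Fin.suc i))

  ℕ→F : ℕ → Carrier
  ℕ→F ℕ.zero    = 0#
  ℕ→F (suc m) = 1# + ℕ→F m

  Mat : ℕ → Set c
  Mat n = Fin n → Fin n → Carrier

  _⊛_ : ∀ {n} → Mat n → Mat n → Mat n
  (A ⊛ B) x y = ∑ λ z → A x z * B z y

  _≈M_ : ∀ {n} → Mat n → Mat n → Set ℓ
  A ≈M B = ∀ x y → A x y ≈ B x y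

  module _ {n d} (S : AssociationScheme n d) where
    open AssociationScheme S

    Adj : Fin (suc d) → Mat n
    Adj i x y = if ⌊ rel x y ≟ i ⌋ then 1# else 0#

    elt : (Fin (suc d) → Carrier) → Mat n
    elt coeff x y = ∑ λ i → coeff i * Adj i x y

    InU : Subset (suc d) → Set (c ⊔ ℓ)
    InU T = Σ (Fin (suc d) → Carrier) λ coeff →
              (∀ i → (i ∈ T) ⇔ (¬ (coeff i ≈ 0#))) ×
              (¬ (coeff zero ≈ 0#)) ×
              (∀ i → (Adj i ⊛ elt coeff) ≈M (λ x y → ℕ→F (val i) * elt coeff x y))

{-# OPTIONS --safe #-}

-- The (x, y) entry of A̅_i v, for v = ∑ c_j A̅_j, is the sum of the coefficients c(rel z y) over the
-- k_i ≤ 2 points z with rel x z = i.  As 2 = 0 in 𝔽, the equation A̅_i v = k̄_i v therefore says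
-- exactly that c(rel z y) = c(rel x y) when k_i = 1, and that the two values c(rel z y) agree when
-- k_i = 2.  Following a path of relations X, Y*, Y, Z with k_X = 1, these two invariances carry a
-- nonzero coefficient c_Z to every relation of R_X R_Y* R_Y R_Z, so the support of v is singular.
-- Conversely the indicator vector of a singular set has both invariances; for k_i = 1 one of the
-- two implications starts its path along R_{i*}, which is thin because k_{i*} = k_i.
module Submission where

open import Defs
open import Level using (Level)
open import Data.Nat using (ℕ)
open import Data.Fin.Subset using (Subset)
open import Function.Bundles using (_⇔_)

open import Algebra.Bundles using (CommutativeMonoid)
import Algebra.Properties.CommutativeMonoid.Sum as CommutativeMonoidSum
open import Data.Bool using (Bool; true; false; T; _∧_; if_then_else_)
open import Data.Bool.Properties using (T-∧; ⇔→≡)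
open import Data.Empty using (⊥-elim)
open import Data.Fin using (Fin; zero; suc; _≟_)
open import Data.Fin.Properties using (punchInᵢ≢i; nonZeroIndex)
open import Data.Fin.Subset using (_∈_)
open import Data.List using (List; []; _∷_; length; map; foldr; filterᵇ; tabulate; allFin)
open import Data.List.Properties using (filter-≐)
open import Data.List.Membership.Propositional using () renaming (_∈_ to _∈ˡ_)
open import Data.List.Membership.Propositional.Properties using (∈-filter⁺; ∈-filter⁻; ∈-allFin; ∈-length)
open import Data.List.Relation.Unary.Any using (here; there)
open import Data.Nat as ℕ using (zero; suc; _≤_; _<_; s≤s)
open import Data.Nat.Properties using (+-0-commutativeMonoid; *-cancelˡ-≡)
open import Data.Product using (∃; ∃₂; _×_; _,_; proj₁; proj₂)
import Data.Product as Product
open import Data.Vec using (lookup)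
open import Data.Vec.Functional using (removeAt; replicate)
open import Data.Vec.Properties using (lookup⇒[]=; []=⇒lookup)
open import Function using (_∘_; id)
open import Function.Bundles using (Equivalence; mk⇔)
open import Relation.Nullary using (¬_; Dec)
open import Relation.Nullary.Decidable
  using (⌊_⌋; T?; toWitness; fromWitness; isYes≗does; dec-true; dec-false; does-⇔)
open import Relation.Binary.PropositionalEquality using (_≡_; _≢_; refl)
import Relation.Binary.PropositionalEquality as ≡

open Equivalence using (to; from)

module ℕΣ = CommutativeMonoidSum +-0-commutativeMonoid

⌊⌋-true : ∀ {p} {P : Set p} (P? : Dec P) → P → ⌊ P? ⌋ ≡ true
⌊⌋-true P? p = ≡.trans (isYes≗does P?) (dec-true P? p)

⌊⌋-false : ∀ {p} {P : Set p} (P? : Dec P) → ¬ P → ⌊ P? ⌋ ≡ false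
⌊⌋-false P? ¬p = ≡.trans (isYes≗does P?) (dec-false P? ¬p)

⌊⌋-⇔ : ∀ {p q} {P : Set p} {Q : Set q} → P ⇔ Q → (P? : Dec P) (Q? : Dec Q) → ⌊ P? ⌋ ≡ ⌊ Q? ⌋
⌊⌋-⇔ P⇔Q P? Q? = ≡.trans (isYes≗does P?) (≡.trans (does-⇔ P⇔Q P? Q?) (≡.sym (isYes≗does Q?)))

∈-filterᵇ : ∀ {A : Set} (Q : A → Bool) xs {x : A} → x ∈ˡ filterᵇ Q xs ⇔ (x ∈ˡ xs × T (Q x))
∈-filterᵇ Q xs = mk⇔ (∈-filter⁻ {P = T ∘ Q} (T? ∘ Q)) (λ (x∈xs , Qx) → ∈-filter⁺ {P = T ∘ Q} (T? ∘ Q) x∈xs Qx)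

T⌊⌋⇔ : ∀ {p} {P : Set p} (P? : Dec P) → T ⌊ P? ⌋ ⇔ P
T⌊⌋⇔ P? = mk⇔ toWitness fromWitness

nonempty⇒∈ : ∀ {A : Set} {xs : List A} → 0 < length xs → ∃ λ x → x ∈ˡ xs
nonempty⇒∈ {xs = x ∷ _} _ = x , here refl

module _ {a ℓ} (M : CommutativeMonoid a ℓ) where
  open CommutativeMonoid M
  open CommutativeMonoidSum M using (sum; sum-remove; sum-cong-≋; sum-replicate-zero)
  open import Relation.Binary.Reasoning.Setoid setoid

  sum-δ : ∀ {m} (f : Fin m → Carrier) k → (∀ j → j ≢ k → f j ≈ ε) → sum f ≈ f k
  sum-δ {suc m} f k f≈ε = begin
    sum f                     ≈⟨ sum-remove {i = k} f ⟩
    f k ∙ sum (removeAt f k)  ≈⟨ ∙-congˡ (sum-cong-≋ (λ j → f≈ε _ (punchInᵢ≢i k j))) ⟩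
    f k ∙ sum (replicate m ε) ≈⟨ ∙-congˡ (sum-replicate-zero m) ⟩
    f k ∙ ε                   ≈⟨ identityʳ (f k) ⟩
    f k                       ∎

ℕΣ-const : ∀ m k → ℕΣ.sum {m} (λ _ → k) ≡ m ℕ.* k
ℕΣ-const zero    k = refl
ℕΣ-const (suc m) k = ≡.cong (k ℕ.+_) (ℕΣ-const m k)

length-filterᵇ-tabulate : ∀ {A : Set} {m} (Q : A → Bool) (f : Fin m → A) →
  length (filterᵇ Q (tabulate f)) ≡ ℕΣ.sum (λ z → if Q (f z) then 1 else 0)
length-filterᵇ-tabulate {m = zero}  Q f = refl
length-filterᵇ-tabulate {m = suc m} Q f with Q (f zero)
... | true  = ≡.cong suc (length-filterᵇ-tabulate Q (f ∘ suc))
... | false = length-filterᵇ-tabulate Q (f ∘ suc)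

module FieldSums {c ℓ} (F : Field c ℓ) where
  open Field F hiding (zero) renaming (refl to ≈-refl)
  open OverField F
  open import Relation.Binary.Reasoning.Setoid setoid

  sumˡ : List Carrier → Carrier
  sumˡ = foldr _+_ 0#

  ∑≡sum : ∀ {m} (f : Fin m → Carrier) → ∑ f ≡ CommutativeMonoidSum.sum +-commutativeMonoid f
  ∑≡sum {zero}  f = refl
  ∑≡sum {suc m} f = ≡.cong (f zero +_) (∑≡sum (f ∘ suc))

  ∑-cong : ∀ {m} {f g : Fin m → Carrier} → (∀ z → f z ≈ g z) → ∑ f ≈ ∑ g
  ∑-cong {zero}  f≈g = ≈-refl
  ∑-cong {suc m} f≈g = +-cong (f≈g zero) (∑-cong (f≈g ∘ suc))

  ∑-δ : ∀ {m} (f : Fin m → Carrier) k → (∀ j → j ≢ k → f j ≈ 0#) → ∑ f ≈ f k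
  ∑-δ f k f≈0 = trans (reflexive (∑≡sum f)) (sum-δ +-commutativeMonoid f k f≈0)

  ∑-filterᵇ-tabulate : ∀ {A : Set} {m} (Q : A → Bool) (f : Fin m → A) (h : A → Carrier) →
    ∑ (λ z → (if Q (f z) then 1# else 0#) * h (f z)) ≈ sumˡ (map h (filterᵇ Q (tabulate f)))
  ∑-filterᵇ-tabulate {m = zero}  Q f h = ≈-refl
  ∑-filterᵇ-tabulate {m = suc m} Q f h with Q (f zero)
  ... | true  = +-cong (*-identityˡ _) (∑-filterᵇ-tabulate Q (f ∘ suc) h)
  ... | false = trans (+-congʳ (zeroˡ _)) (trans (+-identityˡ _) (∑-filterᵇ-tabulate Q (f ∘ suc) h))

  record Balanced {A : Set} (h : A → Carrier) (r : Carrier) (L : List A) : Set ℓ where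
    field
      constant  : ∀ {a b} → a ∈ˡ L → b ∈ˡ L → h a ≈ h b
      singleton : length L ≡ 1 → ∀ {a} → a ∈ˡ L → h a ≈ r

  module Char2Sums (char2 : Char2 F) where

    x+x≈0 : ∀ x → x + x ≈ 0#
    x+x≈0 x = begin
      x + x           ≈⟨ +-cong (*-identityˡ x) (*-identityˡ x) ⟨
      1# * x + 1# * x ≈⟨ distribʳ x 1# 1# ⟨
      (1# + 1#) * x   ≈⟨ *-congʳ char2 ⟩
      0# * x          ≈⟨ zeroˡ x ⟩
      0#              ∎

    x+y≈0⇒x≈y : ∀ {x y} → x + y ≈ 0# → x ≈ y
    x+y≈0⇒x≈y {x} {y} x+y≈0 = begin
      x             ≈⟨ +-identityʳ x ⟨
      x + 0#        ≈⟨ +-congˡ (x+x≈0 y) ⟨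
      x + (y + y)   ≈⟨ +-assoc x y y ⟨
      (x + y) + y   ≈⟨ +-congʳ x+y≈0 ⟩
      0# + y        ≈⟨ +-identityˡ y ⟩
      y             ∎

    sum≈length*⇔balanced : ∀ {A : Set} (h : A → Carrier) r (L : List A) → length L ≤ 2 →
      sumˡ (map h L) ≈ ℕ→F (length L) * r ⇔ Balanced h r L
    sum≈length*⇔balanced h r [] _ = mk⇔
      (λ _ → record { constant = λ () ; singleton = λ () })
      (λ _ → sym (zeroˡ r))
    sum≈length*⇔balanced h r (a ∷ []) _ = mk⇔
      (λ sum≈r → record
        { constant  = λ { (here refl) (here refl) → ≈-refl ; (there ()) ; _ (there ()) }
        ; singleton = λ { _ (here refl) → trans (sym (+-identityʳ (h a))) (trans sum≈r 1r≈r) ; _ (there ()) } })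
      (λ bal → trans (+-identityʳ (h a)) (trans (Balanced.singleton bal refl (here refl)) (sym 1r≈r)))
      where
      1r≈r : (1# + 0#) * r ≈ r
      1r≈r = trans (*-congʳ (+-identityʳ 1#)) (*-identityˡ r)
    sum≈length*⇔balanced h r (a ∷ b ∷ []) _ = mk⇔
      (λ sum≈2r → record
        { constant  = pair-constant (x+y≈0⇒x≈y (trans (+-congˡ (sym (+-identityʳ (h b)))) (trans sum≈2r 2r≈0)))
        ; singleton = λ () })
      (λ bal → begin
        h a + (h b + 0#)     ≈⟨ +-congˡ (+-identityʳ (h b)) ⟩
        h a + h b            ≈⟨ +-congˡ (Balanced.constant bal (there (here refl)) (here refl)) ⟩
        h a + h a            ≈⟨ x+x≈0 (h a) ⟩
        0#                   ≈⟨ 2r≈0 ⟨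
        (1# + (1# + 0#)) * r ∎)
      where
      2r≈0 : (1# + (1# + 0#)) * r ≈ 0#
      2r≈0 = trans (*-congʳ (trans (+-congˡ (+-identityʳ 1#)) char2)) (zeroˡ r)
      pair-constant : h a ≈ h b → ∀ {x y} → x ∈ˡ a ∷ b ∷ [] → y ∈ˡ a ∷ b ∷ [] → h x ≈ h y
      pair-constant ha≈hb (here refl)         (here refl)         = ≈-refl
      pair-constant ha≈hb (here refl)         (there (here refl)) = ha≈hb
      pair-constant ha≈hb (there (here refl)) (here refl)         = sym ha≈hb
      pair-constant ha≈hb (there (here refl)) (there (here refl)) = ≈-refl
    sum≈length*⇔balanced h r (_ ∷ _ ∷ _ ∷ _) (s≤s (s≤s ()))

module SubsetIndicator {c ℓ} (F : Field c ℓ) where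
  open Field F hiding (zero) renaming (refl to ≈-refl)

  indicator : ∀ {m} → Subset m → Fin m → Carrier
  indicator T i = if lookup T i then 1# else 0#

  ∈⇔indicator≉0 : ∀ {m} {T : Subset m} {i : Fin m} → (i ∈ T) ⇔ (¬ indicator T i ≈ 0#)
  ∈⇔indicator≉0 {T = T} {i} = mk⇔ ∈⇒≉0 ≉0⇒∈
    where
    ∈⇒≉0 : i ∈ T → ¬ indicator T i ≈ 0#
    ∈⇒≉0 i∈T rewrite []=⇒lookup i∈T = 0≉1 ∘ sym
    ≉0⇒∈ : ¬ indicator T i ≈ 0# → i ∈ T
    ≉0⇒∈ ≉0 with lookup T i in Tᵢ≡b
    ... | true  = lookup⇒[]= i T Tᵢ≡b
    ... | false = ⊥-elim (≉0 ≈-refl)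

  indicator-cong : ∀ {m} {T : Subset m} {i j : Fin m} → (i ∈ T) ⇔ (j ∈ T) → indicator T i ≈ indicator T j
  indicator-cong {T = T} {i} {j} i∈⇔j∈ = reflexive (≡.cong (if_then 1# else 0#) (⇔→≡ (mk⇔
    (λ Tᵢ → []=⇒lookup (to i∈⇔j∈ (lookup⇒[]= i T Tᵢ)))
    (λ Tⱼ → []=⇒lookup (from i∈⇔j∈ (lookup⇒[]= j T Tⱼ))))))

module SchemeProperties {n d} (S : AssociationScheme n d) where
  open AssociationScheme S
  open ≡.≡-Reasoning

  rel-refl : ∀ x → rel x x ≡ zero
  rel-refl x = from (diag x x) refl

  tr-involutive : ∀ i → tr (tr i) ≡ i
  tr-involutive i with x , y , refl ← nonempty i = ≡.sym (≡.trans (tr-spec y x) (≡.cong tr (tr-spec x y)))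

  rel≡⇔tr : ∀ x y i → rel x y ≡ i ⇔ rel y x ≡ tr i
  rel≡⇔tr x y i = mk⇔
    (λ xy≡i → ≡.trans (tr-spec x y) (≡.cong tr xy≡i))
    (λ yx≡tri → ≡.trans (tr-spec y x) (≡.trans (≡.cong tr yx≡tri) (tr-involutive i)))

  N : Fin n → Fin (suc d) → List (Fin n)
  N x i = filterᵇ (λ z → ⌊ rel x z ≟ i ⌋) (allFin n)

  ∈-N : ∀ {x i z} → z ∈ˡ N x i ⇔ rel x z ≡ i
  ∈-N {x} {i} {z} = mk⇔
    (λ z∈N → to (T⌊⌋⇔ (rel x z ≟ i)) (proj₂ (to (∈-filterᵇ _ (allFin n)) z∈N)))
    (λ xz≡i → from (∈-filterᵇ _ (allFin n)) (∈-allFin z , from (T⌊⌋⇔ (rel x z ≟ i)) xz≡i))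

  -- p_{i i*}^0 counted at (x, x): the condition rel z x ≡ tr i is implied by rel x z ≡ i.
  val≡length-N : ∀ x i → val i ≡ length (N x i)
  val≡length-N x i = ≡.trans (≡.sym (p-spec i (tr i) zero x x (rel-refl x)))
    (≡.cong length (filter-≐ (T? ∘ both) (T? ∘ first) (both⇒first , first⇒both) (allFin n)))
    where
    first both : Fin n → Bool
    first z = ⌊ rel x z ≟ i ⌋
    both  z = ⌊ rel x z ≟ i ⌋ ∧ ⌊ rel z x ≟ tr i ⌋
    both⇒first : ∀ {z} → T (both z) → T (first z)
    both⇒first = proj₁ ∘ to T-∧
    first⇒both : ∀ {z} → T (first z) → T (both z)
    first⇒both {z} t = from T-∧ (t , from (T⌊⌋⇔ (rel z x ≟ tr i)) (to (rel≡⇔tr x z i) (to (T⌊⌋⇔ (rel x z ≟ i)) t)))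

  incidence : Fin (suc d) → Fin n → Fin n → ℕ
  incidence i x z = if ⌊ rel x z ≟ i ⌋ then 1 else 0

  val≡∑incidence : ∀ x i → val i ≡ ℕΣ.sum (incidence i x)
  val≡∑incidence x i = ≡.trans (val≡length-N x i) (length-filterᵇ-tabulate (λ z → ⌊ rel x z ≟ i ⌋) id)

  val-zero : val zero ≡ 1
  val-zero with x , _ ← nonempty zero = begin
    val zero                      ≡⟨ val≡∑incidence x zero ⟩
    ℕΣ.sum (incidence zero x)     ≡⟨ sum-δ +-0-commutativeMonoid (incidence zero x) x off-diagonal ⟩
    incidence zero x x            ≡⟨ ≡.cong (if_then 1 else 0) (⌊⌋-true _ (rel-refl x)) ⟩
    1                             ∎
    where
    off-diagonal : ∀ z → z ≢ x → incidence zero x z ≡ 0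
    off-diagonal z z≢x = ≡.cong (if_then 1 else 0) (⌊⌋-false _ (z≢x ∘ ≡.sym ∘ to (diag x z)))

  n*val≡∑∑incidence : ∀ i → n ℕ.* val i ≡ ℕΣ.sum (λ x → ℕΣ.sum (incidence i x))
  n*val≡∑∑incidence i = ≡.trans (≡.sym (ℕΣ-const n (val i))) (ℕΣ.sum-cong-≗ λ x → val≡∑incidence x i)

  -- Double counting the pairs in R_i: each of the n points has k_i successors and k_{i*} predecessors.
  val-tr : ∀ i → val (tr i) ≡ val i
  val-tr i with x₀ , _ ← nonempty zero =
    ≡.sym (*-cancelˡ-≡ (val i) (val (tr i)) n {{nonZeroIndex x₀}} (begin
      n ℕ.* val i                                       ≡⟨ n*val≡∑∑incidence i ⟩
      ℕΣ.sum (λ x → ℕΣ.sum (λ z → incidence i x z))     ≡⟨ ℕΣ.∑-comm (incidence i) ⟩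
      ℕΣ.sum (λ z → ℕΣ.sum (λ x → incidence i x z))     ≡⟨ ℕΣ.sum-cong-≗ (λ z → ℕΣ.sum-cong-≗ (transpose z)) ⟩
      ℕΣ.sum (λ z → ℕΣ.sum (λ x → incidence (tr i) z x)) ≡⟨ n*val≡∑∑incidence (tr i) ⟨
      n ℕ.* val (tr i)                                  ∎))
    where
    transpose : ∀ z x → incidence i x z ≡ incidence (tr i) z x
    transpose z x = ≡.cong (if_then 1 else 0) (⌊⌋-⇔ (rel≡⇔tr x z i) _ _)

  midpoints : Fin n → Fin (suc d) → Fin (suc d) → Fin n → List (Fin n)
  midpoints a u v e = filterᵇ (λ z → ⌊ rel a z ≟ u ⌋ ∧ ⌊ rel z e ≟ v ⌋) (allFin n)

  ∈-midpoints : ∀ {a u v e z} → z ∈ˡ midpoints a u v e ⇔ (rel a z ≡ u × rel z e ≡ v)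
  ∈-midpoints {a} {u} {v} {e} {z} = mk⇔
    (λ z∈M → Product.map (to (T⌊⌋⇔ (rel a z ≟ u))) (to (T⌊⌋⇔ (rel z e ≟ v)))
               (to T-∧ (proj₂ (to (∈-filterᵇ _ (allFin n)) z∈M))))
    (λ (az≡u , ze≡v) → from (∈-filterᵇ _ (allFin n))
               (∈-allFin z , from T-∧ (from (T⌊⌋⇔ (rel a z ≟ u)) az≡u , from (T⌊⌋⇔ (rel z e ≟ v)) ze≡v)))

  p>0⁺ : ∀ {a b e u v} → rel a b ≡ u → rel b e ≡ v → 0 < p u v (rel a e)
  p>0⁺ {a} {b} {e} {u} {v} ab≡u be≡v =
    ≡.subst (0 <_) (p-spec u v (rel a e) a e refl) (∈-length (from ∈-midpoints (ab≡u , be≡v)))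

  p>0⁻ : ∀ {a e u v k} → rel a e ≡ k → 0 < p u v k → ∃ λ b → rel a b ≡ u × rel b e ≡ v
  p>0⁻ {a} {e} {u} {v} {k} ae≡k p>0
    with b , b∈M ← nonempty⇒∈ {xs = midpoints a u v e} (≡.subst (0 <_) (≡.sym (p-spec u v k a e ae≡k)) p>0)
    = b , to ∈-midpoints b∈M

  path⇒product : ∀ {X Y′ Y Z} p₀ p₁ p₂ p₃ p₄ →
    rel p₀ p₁ ≡ X → rel p₁ p₂ ≡ Y′ → rel p₂ p₃ ≡ Y → rel p₃ p₄ ≡ Z →
    (((⟦ X ⟧ · ⟦ Y′ ⟧) · ⟦ Y ⟧) · ⟦ Z ⟧) (rel p₀ p₄)
  path⇒product p₀ p₁ p₂ p₃ p₄ e₁ e₂ e₃ e₄ =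
    _ , _ , (_ , _ , (_ , _ , refl , refl , p>0⁺ e₁ e₂) , refl , p>0⁺ refl e₃) , refl , p>0⁺ refl e₄

  product⇒path : ∀ {X Y′ Y Z} a e → (((⟦ X ⟧ · ⟦ Y′ ⟧) · ⟦ Y ⟧) · ⟦ Z ⟧) (rel a e) →
    ∃₂ λ b c → ∃ λ d → rel a b ≡ X × rel b c ≡ Y′ × rel c d ≡ Y × rel d e ≡ Z
  product⇒path a e (_ , _ , (_ , _ , (_ , _ , refl , refl , p₁>0) , refl , p₂>0) , refl , p₃>0)
    with d , ad , de ← p>0⁻ refl p₃>0
    with c , ac , cd ← p>0⁻ ad p₂>0
    with b , ab , bc ← p>0⁻ ac p₁>0
    = b , c , d , ab , bc , cd , de

module AdjacencyAlgebra {c ℓ} (F : Field c ℓ) {n d} (S : AssociationScheme n d) where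
  open Field F hiding (zero) renaming (refl to ≈-refl)
  open OverField F
  open FieldSums F
  open SubsetIndicator F
  open AssociationScheme S
  open SchemeProperties S
  open import Relation.Binary.Reasoning.Setoid setoid

  Adj-off : ∀ {i x y} → rel x y ≢ i → Adj S i x y ≈ 0#
  Adj-off {i} {x} {y} xy≢i = reflexive (≡.cong (if_then 1# else 0#) (⌊⌋-false (rel x y ≟ i) xy≢i))

  Adj-on : ∀ {i x y} → rel x y ≡ i → Adj S i x y ≈ 1#
  Adj-on {i} {x} {y} xy≡i = reflexive (≡.cong (if_then 1# else 0#) (⌊⌋-true (rel x y ≟ i) xy≡i))

  elt-entry : ∀ coeff x y → elt S coeff x y ≈ coeff (rel x y)
  elt-entry coeff x y = begin
    ∑ (λ i → coeff i * Adj S i x y)    ≈⟨ ∑-δ (λ i → coeff i * Adj S i x y) (rel x y) (λ i i≢xy → trans (*-congˡ (Adj-off (i≢xy ∘ ≡.sym))) (zeroʳ (coeff i))) ⟩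
    coeff (rel x y) * Adj S (rel x y) x y ≈⟨ *-congˡ (Adj-on refl) ⟩
    coeff (rel x y) * 1#               ≈⟨ *-identityʳ _ ⟩
    coeff (rel x y)                    ∎

  Adj⊛elt-entry : ∀ coeff i x y → (Adj S i ⊛ elt S coeff) x y ≈ sumˡ (map (λ z → coeff (rel z y)) (N x i))
  Adj⊛elt-entry coeff i x y = begin
    ∑ (λ z → Adj S i x z * elt S coeff z y)   ≈⟨ ∑-cong (λ z → *-congˡ (elt-entry coeff z y)) ⟩
    ∑ (λ z → Adj S i x z * coeff (rel z y))   ≈⟨ ∑-filterᵇ-tabulate (λ z → ⌊ rel x z ≟ i ⌋) id (λ z → coeff (rel z y)) ⟩
    sumˡ (map (λ z → coeff (rel z y)) (N x i)) ∎

  Eigenvector : (Fin (suc d) → Carrier) → Set ℓ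
  Eigenvector coeff = ∀ i → (Adj S i ⊛ elt S coeff) ≈M (λ x y → ℕ→F (val i) * elt S coeff x y)

  ThinInvariant PairInvariant : (Fin (suc d) → Carrier) → Set ℓ
  ThinInvariant coeff = ∀ x a y → val (rel x a) ≡ 1 → coeff (rel a y) ≈ coeff (rel x y)
  PairInvariant coeff = ∀ x a b y → rel x a ≡ rel x b → coeff (rel a y) ≈ coeff (rel b y)

  eigen-entry⇔ : ∀ coeff i x y →
    (Adj S i ⊛ elt S coeff) x y ≈ ℕ→F (val i) * elt S coeff x y
      ⇔ sumˡ (map (λ z → coeff (rel z y)) (N x i)) ≈ ℕ→F (length (N x i)) * coeff (rel x y)
  eigen-entry⇔ coeff i x y = mk⇔
    (λ eq → trans (sym (Adj⊛elt-entry coeff i x y)) (trans eq rhs))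
    (λ eq → trans (Adj⊛elt-entry coeff i x y) (trans eq (sym rhs)))
    where
    rhs : ℕ→F (val i) * elt S coeff x y ≈ ℕ→F (length (N x i)) * coeff (rel x y)
    rhs = *-cong (reflexive (≡.cong ℕ→F (val≡length-N x i))) (elt-entry coeff x y)

  eigenvector⇔invariant : Char2 F → QuasiThin S → ∀ coeff →
    Eigenvector coeff ⇔ (ThinInvariant coeff × PairInvariant coeff)
  eigenvector⇔invariant char2 quasiThin coeff = mk⇔
    (λ eigen → (λ x a y θ → Balanced.singleton (balanced eigen (rel x a) x y)
                                 (≡.trans (≡.sym (val≡length-N x (rel x a))) θ) (from ∈-N refl))
             , (λ x a b y xa≡xb → Balanced.constant (balanced eigen (rel x a) x y)
                                 (from ∈-N refl) (from ∈-N (≡.sym xa≡xb))))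
    (λ (thin , pair) i x y → from (eigen-entry⇔ coeff i x y) (from (sum⇔ i x y) record
      { constant  = λ a∈N b∈N → pair x _ _ y (≡.trans (to ∈-N a∈N) (≡.sym (to ∈-N b∈N)))
      ; singleton = λ len≡1 a∈N → thin x _ y (≡.trans (≡.cong val (to ∈-N a∈N)) (≡.trans (val≡length-N x i) len≡1))
      }))
    where
    open Char2Sums char2
    sum⇔ : ∀ i x y → _ ⇔ Balanced (λ z → coeff (rel z y)) (coeff (rel x y)) (N x i)
    sum⇔ i x y = sum≈length*⇔balanced (λ z → coeff (rel z y)) (coeff (rel x y)) (N x i)
                   (≡.subst (_≤ 2) (val≡length-N x i) (quasiThin i))
    balanced : Eigenvector coeff → ∀ i x y → Balanced (λ z → coeff (rel z y)) (coeff (rel x y)) (N x i)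
    balanced eigen i x y = to (sum⇔ i x y) (to (eigen-entry⇔ coeff i x y) (eigen i x y))

  support-singular : ∀ {coeff T} → (∀ i → (i ∈ T) ⇔ (¬ coeff i ≈ 0#)) → ¬ coeff zero ≈ 0# →
    ThinInvariant coeff → PairInvariant coeff → Singular T
  support-singular {coeff} {T} support c₀≉0 thin pair = thin⊆T , closed
    where
    thin⊆T : ∀ i → Oθ i → i ∈ T
    thin⊆T i θ with a , b , refl ← nonempty i = from (support (rel a b)) λ cᵢ≈0 → c₀≉0 (begin
      coeff zero      ≡⟨ ≡.cong coeff (rel-refl b) ⟨
      coeff (rel b b) ≈⟨ thin a b b θ ⟩
      coeff (rel a b) ≈⟨ cᵢ≈0 ⟩
      0#              ∎)
    closed : ∀ X Y Z → Oθ X → Z ∈ T → ∀ w → (((⟦ X ⟧ · ⟦ tr Y ⟧) · ⟦ Y ⟧) · ⟦ Z ⟧) w → w ∈ T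
    closed X Y Z θ Z∈T w w∈XY*YZ
      with a , e , refl ← nonempty w
      with b , c , d , ab , bc , cd , de ← product⇒path a e w∈XY*YZ
      = from (support (rel a e)) λ w≈0 → to (support Z) Z∈T (begin
        coeff Z         ≡⟨ ≡.cong coeff de ⟨
        coeff (rel d e) ≈⟨ pair c d b e (≡.trans cd (≡.sym cb)) ⟩
        coeff (rel b e) ≈⟨ thin a b e (≡.trans (≡.cong val ab) θ) ⟩
        coeff (rel a e) ≈⟨ w≈0 ⟩
        0#              ∎)
      where
      cb : rel c b ≡ Y
      cb = ≡.trans (to (rel≡⇔tr b c (tr Y)) bc) (tr-involutive Y)

  module _ {T} (singular : Singular T) where

    singular-path : ∀ {Y} p₀ p₁ p₂ p₃ p₄ → Oθ (rel p₀ p₁) → rel p₁ p₂ ≡ tr Y → rel p₂ p₃ ≡ Y →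
      rel p₃ p₄ ∈ T → rel p₀ p₄ ∈ T
    singular-path p₀ p₁ p₂ p₃ p₄ θ e₁ e₂ Z∈T =
      proj₂ singular _ _ _ θ Z∈T _ (path⇒product p₀ p₁ p₂ p₃ p₄ refl e₁ e₂ refl)

    -- Both paths pause at one point for their middle two steps, taking Y = rel a a (its own transpose).
    indicator-thin : ThinInvariant (indicator T)
    indicator-thin x a y θ = indicator-cong (mk⇔
      (singular-path x a a a y θ (tr-spec a a) refl)
      (singular-path a x x x y (≡.trans (≡.cong val (tr-spec x a)) (≡.trans (val-tr (rel x a)) θ)) (tr-spec x x) refl))

    indicator-pair : PairInvariant (indicator T)
    indicator-pair x a b y xa≡xb = indicator-cong (mk⇔ (via a b xa≡xb) (via b a (≡.sym xa≡xb)))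
      where
      via : ∀ a b → rel x a ≡ rel x b → rel a y ∈ T → rel b y ∈ T
      via a b xa≡xb = singular-path b b x a y (≡.trans (≡.cong val (rel-refl b)) val-zero)
                        (≡.trans (tr-spec x b) (≡.cong tr (≡.sym xa≡xb))) refl

proposition3p14 : ∀ {c ℓ : Level} (F : Field c ℓ) → Char2 F →
    ∀ {n d : ℕ} (S : AssociationScheme n d) → QuasiThin S →
    ∀ (T : Subset (Data.Nat.suc d)) →
      OverField.InU F S T ⇔ AssociationScheme.Singular S T
proposition3p14 F char2 S quasiThin T = mk⇔ 𝒰⇒𝒮 𝒮⇒𝒰
  where
  open AssociationScheme S
  open SchemeProperties S
  open SubsetIndicator F
  open AdjacencyAlgebra F S
  𝒰⇒𝒮 : OverField.InU F S T → Singular T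
  𝒰⇒𝒮 (coeff , support , c₀≉0 , eigen) =
    let thin , pair = to (eigenvector⇔invariant char2 quasiThin coeff) eigen
    in support-singular support c₀≉0 thin pair
  𝒮⇒𝒰 : Singular T → OverField.InU F S T
  𝒮⇒𝒰 singular = indicator T , (λ _ → ∈⇔indicator≉0) , to ∈⇔indicator≉0 (proj₁ singular zero val-zero)
    , from (eigenvector⇔invariant char2 quasiThin (indicator T)) (indicator-thin singular , indicator-pair singular)
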